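{- For any nonempty set $X$ of vertices of $K^s_{10;3}$, the number of vertices joined by a positive edge to at least one vertex of $X$ is at least $\min\{10,|X|+4\}$, and the same holds for negative edges.
   Context: $K^s_{10;3}$ is the signed graph on $\mathbb{Z}_{10}=\{0,\dots,9\}$ where $j,k$ are joined by a positive edge iff their cyclic distance is at most $2$ (every vertex has a positive loop, joining it to itself), and by a negative edge iff their cyclic distance is at least $3$. -}

module Defs where

open import Data.Nat using (ℕ; _≤ᵇ_; _∸_; ∣_-_∣; _⊓_)
open import Data.Bool using (Bool; true; false; not; _∧_; _∨_)
open import Data.Fin using (Fin; toℕ)
open import Data.Fin.Subset using (Subset)
open import Data.Vec using (tabulate; lookup; foldr′; zipWith)

V : Set
V = Fin 10

cdist : V → V → ℕ
cdist j k = ∣ toℕ j - toℕ k ∣ ⊓ (10 ∸ ∣ toℕ j - toℕ k ∣)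

-- A signed graph on V given by its two edge relations (as Boolean adjacency)
-- positive edge of K^s_{10;3}: cyclic distance ≤ 2 (includes the loops, distance 0)
pos : V → V → Bool
pos j k = cdist j k ≤ᵇ 2

neg : V → V → Bool
neg j k = not (cdist j k ≤ᵇ 2)

adjToSome : (V → V → Bool) → Subset 10 → V → Bool
adjToSome E X v = foldr′ _∨_ false (zipWith _∧_ X (tabulate λ x → E x v))

nbhd : (V → V → Bool) → Subset 10 → Subset 10
nbhd E X = tabulate (adjToSome E X)

module Submission where

open import Defs
open import Level using (Level)
open import Data.Bool using (Bool)
open import Data.Nat using (ℕ; _≤_; _≤?_; _+_; _⊓_)
open import Data.Product using (_×_; _,_)
open import Data.Fin.Subset using (Subset; Nonempty; ∣_∣)
open import Data.Fin.Subset.Properties using (nonempty?; anySubset?)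
open import Relation.Nullary using (Dec; ¬?; _×-dec_; _→-dec_; map′; decidable-stable; from-yes)
open import Relation.Unary using (Pred; Decidable)

private
  variable
    ℓ : Level
    n : ℕ

allSubsets? : {P : Pred (Subset n) ℓ} → Decidable P → Dec (∀ p → P p)
allSubsets? P? = map′
  (λ noCounterexample p → decidable-stable (P? p) (λ ¬Pp → noCounterexample (p , ¬Pp)))
  (λ ∀P (p , ¬Pp) → ¬Pp (∀P p))
  (¬? (anySubset? (λ p → ¬? (P? p))))

Expands : (V → V → Bool) → Subset 10 → Set
Expands E X = 10 ⊓ (∣ X ∣ + 4) ≤ ∣ nbhd E X ∣

expands? : ∀ E → Decidable (Expands E)
expands? E X = _ ≤? ∣ nbhd E X ∣

-- There are only 2¹⁰ vertex sets, so the bound is checked for each of them by evaluation.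
lemma2p8 : (X : Subset 10) → Nonempty X →
    (10 ⊓ (∣ X ∣ + 4) ≤ ∣ nbhd pos X ∣) × (10 ⊓ (∣ X ∣ + 4) ≤ ∣ nbhd neg X ∣)
lemma2p8 = from-yes (allSubsets? λ X → nonempty? X →-dec (expands? pos X ×-dec expands? neg X))
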